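{- For every $n\ge 1$, the mixed separated number of $K_{n,n}$ is at most $\lceil\frac{2n}{3}\rceil$.
   Context: Let $K_{n,n}$ have parts $U=\{u_0,\ldots,u_{n-1}\}$ and $V=\{v_0,\ldots,v_{n-1}\}$. A vertex order is separated if all vertices of one part precede all vertices of the other part. Given a total vertex order $\prec$, two edges $(a_1,b_1)$, $(a_2,b_2)$ with four distinct endpoints and $a_1\prec b_1$, $a_2 \prec b_2$, $a_1 \prec a_2$ are said to cross if $a_1 \prec a_2 \prec b_1 \prec b_2$, and to nest if $a_1 \prec a_2 \prec b_2 \prec b_1$. A stack is a set of edges no two of which cross; a queue is a set of edges no two of which nest. The mixed separated number of $K_{n,n}$ is the minimum $s+q$ such that there is a separated vertex order of $K_{n,n}$ and a partition of its edges into $s$ stacks and $q$ queues with respect to that order. -}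

module Defs where

open import Data.Nat using (ℕ; _+_; _*_; _<_; _≤_; _⊓_; _⊔_)
open import Data.Nat.DivMod using (_/_)
open import Data.Fin using (Fin)
open import Data.Sum using (_⊎_; inj₁; inj₂)
open import Data.Product using (_×_; Σ; ∃; ∃-syntax)
open import Relation.Nullary using (¬_)
open import Function.Definitions using (Injective)
open import Relation.Binary.PropositionalEquality using (_≡_)

-- Vertices of K_{n,n}: inj₁ i = u_i ∈ U, inj₂ j = v_j ∈ V.
Vertex : ℕ → Set
Vertex n = Fin n ⊎ Fin n

-- Edges of K_{n,n}: (i , j) stands for the edge u_i v_j.
Edge : ℕ → Set
Edge n = Fin n × Fin n

-- A total vertex order, given by an injective position map: x ≺ y iff pos x < pos y.
record VertexOrder (n : ℕ) : Set where
  field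
    pos   : Vertex n → ℕ
    inj   : Injective _≡_ _≡_ pos

open VertexOrder public

Separated : {n : ℕ} → VertexOrder n → Set
Separated {n} o =
  ((i j : Fin n) → pos o (inj₁ i) < pos o (inj₂ j)) ⊎
  ((i j : Fin n) → pos o (inj₂ j) < pos o (inj₁ i))

lo hi : {n : ℕ} → VertexOrder n → Edge n → ℕ
lo o (i Data.Product., j) = pos o (inj₁ i) ⊓ pos o (inj₂ j)
hi o (i Data.Product., j) = pos o (inj₁ i) ⊔ pos o (inj₂ j)

-- e and f cross: a₁ ≺ a₂ ≺ b₁ ≺ b₂ for some labelling (strictness forces four distinct endpoints)
Cross : {n : ℕ} → VertexOrder n → Edge n → Edge n → Set
Cross o e f =
  (lo o e < lo o f × lo o f < hi o e × hi o e < hi o f) ⊎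
  (lo o f < lo o e × lo o e < hi o f × hi o f < hi o e)

Nest : {n : ℕ} → VertexOrder n → Edge n → Edge n → Set
Nest o e f =
  (lo o e < lo o f × lo o f < hi o f × hi o f < hi o e) ⊎
  (lo o f < lo o e × lo o e < hi o e × hi o e < hi o f)

record MixedLayout (n s q : ℕ) (o : VertexOrder n) : Set where
  field
    colour   : Edge n → Fin s ⊎ Fin q
    stackOK  : (k : Fin s) (e f : Edge n) → colour e ≡ inj₁ k → colour f ≡ inj₁ k → ¬ Cross o e f
    queueOK  : (k : Fin q) (e f : Edge n) → colour e ≡ inj₂ k → colour f ≡ inj₂ k → ¬ Nest o e f

MixedSepNumberAtMost : ℕ → ℕ → Set
MixedSepNumberAtMost n m =
  ∃[ s ] ∃[ q ] (s + q ≤ m × Σ (VertexOrder n) λ o → Separated o × MixedLayout n s q o)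

-- ⌈ 2n / 3 ⌉
ceil2n/3 : ℕ → ℕ
ceil2n/3 n = (2 * n + 2) / 3

-- Write n = 3k + r with r < 3 and put U before V. Then the edge u_x v_y is the cell (x , y) of an
-- n × n grid, two edges cross iff their cells increase strictly in both coordinates, and they nest
-- iff the cells increase strictly in x and decrease strictly in y. Cut the first 3k rows and
-- columns into 3 × 3 blocks of side k and write a, b for the offsets inside a block. The blocks
-- (1,0), (2,0), (0,2), (1,2) are covered by k stacks: stack i consists of the L-shapes
-- min(a,b) = i, max(a,b) = i, min(a,b) = i, max(a,b) = i, which together form one descending
-- staircase. The other five blocks are covered in the same way by k queues, reading the column
-- offset backwards. The last r rows and columns form r nested hooks, each of them a stack. So
-- 2k + r = ⌈2n/3⌉ classes suffice; in each class the index strictly increases along every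
-- forbidden pair of cells, which rules such pairs out.
module Submission where

open import Defs
open import Data.Nat
  using (ℕ; _≥_; suc; _+_; _*_; _∸_; _<_; _≤_; _⊓_; _⊔_; z≤n; z<s; s<s; s≤s⁻¹; _<?_)
open import Data.Nat.Properties
open import Data.Nat.DivMod using (_/_; _%_; m*n/n≡m; /-monoˡ-≤; m≡m%n+[m/n]*n; m%n<n)
open import Data.Nat.Solver using (module +-*-Solver)
open import Data.Fin as Fin using (Fin; toℕ; fromℕ<)
open import Data.Fin.Properties using (toℕ-fromℕ<; toℕ-injective; toℕ<n)
open import Data.Sum using (_⊎_; inj₁; inj₂)
open import Data.Sum.Relation.Unary.All as Sum using (All)
open import Data.Product using (_×_; _,_)
open import Data.Empty using (⊥; ⊥-elim)
open import Relation.Nullary using (¬_; yes; no)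
open import Function.Definitions using (Injective)
open import Relation.Binary.PropositionalEquality

record GridColouring (n s q : ℕ) : Set where
  field
    colour     : Fin n → Fin n → ℕ ⊎ ℕ
    bounded    : ∀ x y → All (_< s) (_< q) (colour x y)
    stack-free : ∀ {x x' y y' i} → x Fin.< x' → y Fin.< y' →
                 colour x y ≡ inj₁ i → colour x' y' ≡ inj₁ i → ⊥
    queue-free : ∀ {x x' y y' i} → x Fin.< x' → y' Fin.< y →
                 colour x y ≡ inj₂ i → colour x' y' ≡ inj₂ i → ⊥

All-inj₁ : ∀ {A B : Set} {P : A → Set} {Q : B → Set} {c : A ⊎ B} {a : A} →
           All P Q c → c ≡ inj₁ a → P a
All-inj₁ (Sum.inj₁ p) refl = p

fromBounded : ∀ {s q} {c : ℕ ⊎ ℕ} → All (_< s) (_< q) c → Fin s ⊎ Fin q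
fromBounded (Sum.inj₁ i<s) = inj₁ (fromℕ< i<s)
fromBounded (Sum.inj₂ i<q) = inj₂ (fromℕ< i<q)

fromBounded-inj₁ : ∀ {s q} {c : ℕ ⊎ ℕ} {K : Fin s} (p : All (_< s) (_< q) c) →
                   fromBounded p ≡ inj₁ K → c ≡ inj₁ (toℕ K)
fromBounded-inj₁ (Sum.inj₁ i<s) refl = cong inj₁ (sym (toℕ-fromℕ< i<s))

fromBounded-inj₂ : ∀ {s q} {c : ℕ ⊎ ℕ} {K : Fin q} (p : All (_< s) (_< q) c) →
                   fromBounded p ≡ inj₂ K → c ≡ inj₂ (toℕ K)
fromBounded-inj₂ (Sum.inj₂ i<q) refl = cong inj₂ (sym (toℕ-fromℕ< i<q))

module UBeforeV (n : ℕ) where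

  position : Vertex n → ℕ
  position (inj₁ i) = toℕ i
  position (inj₂ j) = n + toℕ j

  U<V : (i j : Fin n) → toℕ i < n + toℕ j
  U<V i j = <-≤-trans (toℕ<n i) (m≤m+n n (toℕ j))

  position-injective : Injective _≡_ _≡_ position
  position-injective {inj₁ i} {inj₁ i'} p = cong inj₁ (toℕ-injective p)
  position-injective {inj₁ i} {inj₂ j}  p = ⊥-elim (<-irrefl p (U<V i j))
  position-injective {inj₂ j} {inj₁ i}  p = ⊥-elim (<-irrefl (sym p) (U<V i j))
  position-injective {inj₂ j} {inj₂ j'} p = cong inj₂ (toℕ-injective (+-cancelˡ-≡ n _ _ p))

  order : VertexOrder n
  order = record { pos = position ; inj = position-injective }

  separated : Separated order
  separated = inj₁ U<V

  lo≡ : (i j : Fin n) → lo order (i , j) ≡ toℕ i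
  lo≡ i j = m≤n⇒m⊓n≡m (<⇒≤ (U<V i j))

  hi≡ : (i j : Fin n) → hi order (i , j) ≡ n + toℕ j
  hi≡ i j = m≤n⇒m⊔n≡n (<⇒≤ (U<V i j))

  lo-< : ∀ {i j i' j' : Fin n} → lo order (i , j) < lo order (i' , j') → i Fin.< i'
  lo-< {i} {j} {i'} {j'} = subst₂ _<_ (lo≡ i j) (lo≡ i' j')

  hi-< : ∀ {i j i' j' : Fin n} → hi order (i , j) < hi order (i' , j') → j Fin.< j'
  hi-< {i} {j} {i'} {j'} p = +-cancelˡ-< n _ _ (subst₂ _<_ (hi≡ i j) (hi≡ i' j') p)

  cross⇒increasing : ∀ {i j i' j' : Fin n} → Cross order (i , j) (i' , j') →
                     (i Fin.< i' × j Fin.< j') ⊎ (i' Fin.< i × j' Fin.< j)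
  cross⇒increasing (inj₁ (lo< , _ , hi<)) = inj₁ (lo-< lo< , hi-< hi<)
  cross⇒increasing (inj₂ (lo< , _ , hi<)) = inj₂ (lo-< lo< , hi-< hi<)

  nest⇒decreasing : ∀ {i j i' j' : Fin n} → Nest order (i , j) (i' , j') →
                    (i Fin.< i' × j' Fin.< j) ⊎ (i' Fin.< i × j Fin.< j')
  nest⇒decreasing (inj₁ (lo< , _ , hi<)) = inj₁ (lo-< lo< , hi-< hi<)
  nest⇒decreasing (inj₂ (lo< , _ , hi<)) = inj₂ (lo-< lo< , hi-< hi<)

gridColouring⇒mixedSepNumber : ∀ {n s q m} → GridColouring n s q → s + q ≤ m →
                               MixedSepNumberAtMost n m
gridColouring⇒mixedSepNumber {n} {s} {q} G s+q≤m = s , q , s+q≤m , order , separated , layout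
  where
  open GridColouring G
  open UBeforeV n

  edgeColour : Edge n → Fin s ⊎ Fin q
  edgeColour (x , y) = fromBounded (bounded x y)

  stackOK : (K : Fin s) (e f : Edge n) → edgeColour e ≡ inj₁ K → edgeColour f ≡ inj₁ K →
            ¬ Cross order e f
  stackOK K (x , y) (x' , y') ce cf cross with cross⇒increasing cross
  ... | inj₁ (x<x' , y<y') = stack-free x<x' y<y' (fromBounded-inj₁ _ ce) (fromBounded-inj₁ _ cf)
  ... | inj₂ (x'<x , y'<y) = stack-free x'<x y'<y (fromBounded-inj₁ _ cf) (fromBounded-inj₁ _ ce)

  queueOK : (K : Fin q) (e f : Edge n) → edgeColour e ≡ inj₂ K → edgeColour f ≡ inj₂ K →
            ¬ Nest order e f
  queueOK K (x , y) (x' , y') ce cf nest with nest⇒decreasing nest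
  ... | inj₁ (x<x' , y'<y) = queue-free x<x' y'<y (fromBounded-inj₂ _ ce) (fromBounded-inj₂ _ cf)
  ... | inj₂ (x'<x , y<y') = queue-free x'<x y<y' (fromBounded-inj₂ _ cf) (fromBounded-inj₂ _ ce)

  layout : MixedLayout n s q order
  layout = record { colour = edgeColour ; stackOK = stackOK ; queueOK = queueOK }

m<o⇒m⊓n<o⊔p : ∀ {m n o} p → m < o → m ⊓ n < o ⊔ p
m<o⇒m⊓n<o⊔p {m} {n} {o} p m<o = ≤-<-trans (m⊓n≤m m n) (<-≤-trans m<o (m≤m⊔n o p))

n<p⇒m⊓n<o⊔p : ∀ {m n p} o → n < p → m ⊓ n < o ⊔ p
n<p⇒m⊓n<o⊔p {m} {n} {p} o n<p = ≤-<-trans (m⊓n≤n m n) (<-≤-trans n<p (m≤n⊔m o p))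

data Block : Set where
  b₀ b₁ b₂ : Block

data _<ᴮ_ : Block → Block → Set where
  b₀<b₁ : b₀ <ᴮ b₁
  b₀<b₂ : b₀ <ᴮ b₂
  b₁<b₂ : b₁ <ᴮ b₂

blockStart : ℕ → Block → ℕ
blockStart k b₀ = 0
blockStart k b₁ = k
blockStart k b₂ = k + k

blockStart+k≤blockStart : ∀ k {X X'} → X <ᴮ X' → blockStart k X + k ≤ blockStart k X'
blockStart+k≤blockStart k b₀<b₁ = ≤-refl
blockStart+k≤blockStart k b₀<b₂ = m≤m+n k k
blockStart+k≤blockStart k b₁<b₂ = ≤-refl

blockStart+k≤3k : ∀ k X → blockStart k X + k ≤ 3 * k
blockStart+k≤3k k b₀ = m≤m+n k (2 * k)
blockStart+k≤3k k b₁ = +-monoʳ-≤ k (m≤m+n k (1 * k))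
blockStart+k≤3k k b₂ =
  ≤-reflexive (trans (+-assoc k k k) (cong (λ m → k + (k + m)) (sym (+-identityʳ k))))

blockStart+a<3k : ∀ {k} X {a} → a < k → blockStart k X + a < 3 * k
blockStart+a<3k {k} X a<k = <-≤-trans (+-monoʳ-< (blockStart k X) a<k) (blockStart+k≤3k k X)

data Lex : Block → ℕ → Block → ℕ → Set where
  within : ∀ {X a a'} → a < a' → Lex X a X a'
  across : ∀ {X X' a a'} → X <ᴮ X' → Lex X a X' a'

earlier-block-< : ∀ {k X X' a a'} → X <ᴮ X' → a < k → blockStart k X + a < blockStart k X' + a'
earlier-block-< {k} {X} {X'} {a} {a'} X<X' a<k =
  <-≤-trans (+-monoʳ-< (blockStart k X) a<k)
            (≤-trans (blockStart+k≤blockStart k X<X') (m≤m+n (blockStart k X') a'))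

block-lex : ∀ {k X X' a a'} → a < k → a' < k →
            blockStart k X + a < blockStart k X' + a' → Lex X a X' a'
block-lex {k} {b₀} {b₀} _ _ p = within p
block-lex {k} {b₁} {b₁} _ _ p = within (+-cancelˡ-< k _ _ p)
block-lex {k} {b₂} {b₂} _ _ p = within (+-cancelˡ-< (k + k) _ _ p)
block-lex {X = b₀} {b₁} _ _ _ = across b₀<b₁
block-lex {X = b₀} {b₂} _ _ _ = across b₀<b₂
block-lex {X = b₁} {b₂} _ _ _ = across b₁<b₂
block-lex {X = b₁} {b₀} _ a'<k p = ⊥-elim (<-asym p (earlier-block-< b₀<b₁ a'<k))
block-lex {X = b₂} {b₀} _ a'<k p = ⊥-elim (<-asym p (earlier-block-< b₀<b₂ a'<k))
block-lex {X = b₂} {b₁} _ a'<k p = ⊥-elim (<-asym p (earlier-block-< b₁<b₂ a'<k))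

data StackBlock : Block → Block → Set where
  s₁₀ : StackBlock b₁ b₀
  s₂₀ : StackBlock b₂ b₀
  s₀₂ : StackBlock b₀ b₂
  s₁₂ : StackBlock b₁ b₂

stackIndex : ∀ {X Y} → StackBlock X Y → ℕ → ℕ → ℕ
stackIndex s₁₀ a b = a ⊓ b
stackIndex s₂₀ a b = a ⊔ b
stackIndex s₀₂ a b = a ⊓ b
stackIndex s₁₂ a b = a ⊔ b

stackIndex-increasing : ∀ {X Y X' Y' a b a' b'} (t : StackBlock X Y) (t' : StackBlock X' Y') →
                        Lex X a X' a' → Lex Y b Y' b' → stackIndex t a b < stackIndex t' a' b'
stackIndex-increasing s₁₂ () (across b₁<b₂) (within _)
stackIndex-increasing s₁₀ s₁₀ (within a<a') (within b<b') = ⊓-mono-< a<a' b<b'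
stackIndex-increasing s₂₀ s₂₀ (within a<a') (within b<b') = ⊔-mono-< a<a' b<b'
stackIndex-increasing s₀₂ s₀₂ (within a<a') (within b<b') = ⊓-mono-< a<a' b<b'
stackIndex-increasing s₁₂ s₁₂ (within a<a') (within b<b') = ⊔-mono-< a<a' b<b'
stackIndex-increasing s₁₀ s₂₀ (across _) (within b<b') = n<p⇒m⊓n<o⊔p _ b<b'
stackIndex-increasing s₁₀ s₁₂ (within a<a') (across _) = m<o⇒m⊓n<o⊔p _ a<a'
stackIndex-increasing s₀₂ s₁₂ (across _) (within b<b') = n<p⇒m⊓n<o⊔p _ b<b'

stackIndex-< : ∀ {k X Y a b} (t : StackBlock X Y) → a < k → b < k → stackIndex t a b < k
stackIndex-< s₁₀ a<k _   = m<n⇒m⊓o<n _ a<k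
stackIndex-< s₂₀ a<k b<k = ⊔-pres-<m a<k b<k
stackIndex-< s₀₂ a<k _   = m<n⇒m⊓o<n _ a<k
stackIndex-< s₁₂ a<k b<k = ⊔-pres-<m a<k b<k

mirror : ℕ → ℕ → ℕ
mirror k b = k ∸ suc b

mirror-< : ∀ {k b} → b < k → mirror k b < k
mirror-< b<k = ∸-monoʳ-< z<s b<k

mirror-reverses-< : ∀ {k b b'} → b < k → b' < b → mirror k b < mirror k b'
mirror-reverses-< b<k b'<b = ∸-monoʳ-< (s<s b'<b) b<k

data QueueBlock : Block → Block → Set where
  q₀₀ : QueueBlock b₀ b₀
  q₀₁ : QueueBlock b₀ b₁
  q₁₁ : QueueBlock b₁ b₁
  q₂₁ : QueueBlock b₂ b₁
  q₂₂ : QueueBlock b₂ b₂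

queueIndex : ∀ {X Y} → QueueBlock X Y → ℕ → ℕ → ℕ
queueIndex q₀₀ a c = a ⊔ c
queueIndex q₀₁ a c = a ⊓ c
queueIndex q₁₁ a c = c
queueIndex q₂₁ a c = a ⊔ c
queueIndex q₂₂ a c = a ⊓ c

queueIndex-increasing : ∀ {k X Y X' Y' a b a' b'} (t : QueueBlock X Y) (t' : QueueBlock X' Y') →
                        b < k → Lex X a X' a' → Lex Y' b' Y b →
                        queueIndex t a (mirror k b) < queueIndex t' a' (mirror k b')
queueIndex-increasing q₀₁ q₀₀ _ (across ()) (across _)
queueIndex-increasing q₁₁ q₀₁ _ (across ()) (within _)
queueIndex-increasing q₁₁ q₀₀ _ (across ()) (across _)
queueIndex-increasing q₂₁ () _ (within _) (across b₀<b₁)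
queueIndex-increasing q₀₀ q₀₀ b<k (within a<a') (within b'<b) =
  ⊔-mono-< a<a' (mirror-reverses-< b<k b'<b)
queueIndex-increasing q₀₁ q₀₁ b<k (within a<a') (within b'<b) =
  ⊓-mono-< a<a' (mirror-reverses-< b<k b'<b)
queueIndex-increasing q₁₁ q₁₁ b<k _ (within b'<b) =
  mirror-reverses-< b<k b'<b
queueIndex-increasing q₂₁ q₂₁ b<k (within a<a') (within b'<b) =
  ⊔-mono-< a<a' (mirror-reverses-< b<k b'<b)
queueIndex-increasing q₂₂ q₂₂ b<k (within a<a') (within b'<b) =
  ⊓-mono-< a<a' (mirror-reverses-< b<k b'<b)
queueIndex-increasing q₀₁ q₀₀ _ (within a<a') (across _) =
  m<o⇒m⊓n<o⊔p _ a<a'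
queueIndex-increasing q₀₁ q₁₁ b<k (across _) (within b'<b) =
  m<n⇒o⊓m<n _ (mirror-reverses-< b<k b'<b)
queueIndex-increasing q₀₁ q₂₁ b<k (across _) (within b'<b) =
  n<p⇒m⊓n<o⊔p _ (mirror-reverses-< b<k b'<b)
queueIndex-increasing q₁₁ q₂₁ b<k (across _) (within b'<b) =
  <-≤-trans (mirror-reverses-< b<k b'<b) (m≤n⊔m _ _)
queueIndex-increasing q₂₂ q₂₁ _ (within a<a') (across _) =
  m<o⇒m⊓n<o⊔p _ a<a'

queueIndex-< : ∀ {k X Y a c} (t : QueueBlock X Y) → a < k → c < k → queueIndex t a c < k
queueIndex-< q₀₀ a<k c<k = ⊔-pres-<m a<k c<k
queueIndex-< q₀₁ a<k _   = m<n⇒m⊓o<n _ a<k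
queueIndex-< q₁₁ _   c<k = c<k
queueIndex-< q₂₁ a<k c<k = ⊔-pres-<m a<k c<k
queueIndex-< q₂₂ a<k _   = m<n⇒m⊓o<n _ a<k

BlockType : Block → Block → Set
BlockType X Y = StackBlock X Y ⊎ QueueBlock X Y

blockType : (X Y : Block) → BlockType X Y
blockType b₀ b₀ = inj₂ q₀₀
blockType b₀ b₁ = inj₂ q₀₁
blockType b₀ b₂ = inj₁ s₀₂
blockType b₁ b₀ = inj₁ s₁₀
blockType b₁ b₁ = inj₂ q₁₁
blockType b₁ b₂ = inj₁ s₁₂
blockType b₂ b₀ = inj₁ s₂₀
blockType b₂ b₁ = inj₂ q₂₁
blockType b₂ b₂ = inj₂ q₂₂

blockColour : ∀ {X Y} → ℕ → BlockType X Y → ℕ → ℕ → ℕ ⊎ ℕ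
blockColour k (inj₁ t) a b = inj₁ (stackIndex t a b)
blockColour k (inj₂ t) a b = inj₂ (queueIndex t a (mirror k b))

blockColour-bounded : ∀ {k s X Y a b} (t : BlockType X Y) → a < k → b < k → k ≤ s →
                      All (_< s) (_< k) (blockColour k t a b)
blockColour-bounded (inj₁ t) a<k b<k k≤s = Sum.inj₁ (<-≤-trans (stackIndex-< t a<k b<k) k≤s)
blockColour-bounded (inj₂ t) a<k b<k _   = Sum.inj₂ (queueIndex-< t a<k (mirror-< b<k))

blockColour-stack-increasing :
  ∀ {k X Y X' Y' a b a' b' i i'} (t : BlockType X Y) (t' : BlockType X' Y') →
  Lex X a X' a' → Lex Y b Y' b' →
  blockColour k t a b ≡ inj₁ i → blockColour k t' a' b' ≡ inj₁ i' → i < i'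
blockColour-stack-increasing (inj₁ t) (inj₁ t') x<x' y<y' refl refl =
  stackIndex-increasing t t' x<x' y<y'

blockColour-queue-increasing :
  ∀ {k X Y X' Y' a b a' b' i i'} (t : BlockType X Y) (t' : BlockType X' Y') →
  b < k → Lex X a X' a' → Lex Y' b' Y b →
  blockColour k t a b ≡ inj₂ i → blockColour k t' a' b' ≡ inj₂ i' → i < i'
blockColour-queue-increasing (inj₂ t) (inj₂ t') b<k x<x' y'<y refl refl =
  queueIndex-increasing t t' b<k x<x' y'<y

data Split (k : ℕ) : ℕ → Set where
  below : ∀ {x} → x < k → Split k x
  above : ∀ d → Split k (k + d)

split : ∀ k x → Split k x
split k x with x <? k
... | yes x<k = below x<k
... | no x≮k with m≤n⇒∃[o]m+o≡n (≮⇒≥ x≮k)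
...   | d , refl = above d

data View (k : ℕ) : ℕ → Set where
  block : ∀ X {a} → a < k → View k (blockStart k X + a)
  tail  : ∀ {x} → 3 * k ≤ x → View k x

view : ∀ k x → View k x
view k x with split k x
... | below a<k = block b₀ a<k
... | above d with split k d
...   | below a<k = block b₁ a<k
...   | above e with split k e
...     | below a<k = subst (View k) (+-assoc k k e) (block b₂ a<k)
...     | above f   = tail (+-monoʳ-≤ k (+-monoʳ-≤ k (+-monoʳ-≤ k z≤n)))

data CellView (k : ℕ) : ℕ → ℕ → Set where
  core : ∀ X Y {a b} → a < k → b < k → CellView k (blockStart k X + a) (blockStart k Y + b)
  hook : ∀ {x y} → 3 * k ≤ x ⊔ y → CellView k x y

cellView : ∀ k x y → CellView k x y
cellView k x y with view k x | view k y
... | block X a<k | block Y b<k = core X Y a<k b<k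
... | tail 3k≤x   | _           = hook (≤-trans 3k≤x (m≤m⊔n x y))
... | block _ _   | tail 3k≤y   = hook (≤-trans 3k≤y (m≤n⊔m x y))

hookIndex : ℕ → ℕ → ℕ → ℕ
hookIndex k x y = k + (x ⊔ y ∸ 3 * k)

hookIndex-increasing : ∀ {k x y x' y'} → 3 * k ≤ x ⊔ y → x < x' → y < y' →
                       hookIndex k x y < hookIndex k x' y'
hookIndex-increasing {k} 3k≤x⊔y x<x' y<y' =
  +-monoʳ-< k (∸-monoˡ-< (⊔-mono-< x<x' y<y') 3k≤x⊔y)

hookIndex-< : ∀ {k r x y} → 3 * k ≤ x ⊔ y → x < 3 * k + r → y < 3 * k + r →
              hookIndex k x y < k + r
hookIndex-< {k} {r} {x} {y} 3k≤x⊔y x<n y<n =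
  +-monoʳ-< k (+-cancelˡ-< (3 * k) _ _
    (subst (_< 3 * k + r) (sym (m+[n∸m]≡n 3k≤x⊔y)) (⊔-pres-<m x<n y<n)))

cellColour : ∀ {k x y} → CellView k x y → ℕ ⊎ ℕ
cellColour {k}         (core X Y {a} {b} _ _) = blockColour k (blockType X Y) a b
cellColour {k} {x} {y} (hook _)               = inj₁ (hookIndex k x y)

cellColour-bounded : ∀ {k r x y} (c : CellView k x y) → x < 3 * k + r → y < 3 * k + r →
                     All (_< k + r) (_< k) (cellColour c)
cellColour-bounded {k} {r} (core X Y a<k b<k) _ _ =
  blockColour-bounded (blockType X Y) a<k b<k (m≤m+n k r)
cellColour-bounded {k} (hook 3k≤x⊔y) x<n y<n = Sum.inj₁ (hookIndex-< {k} 3k≤x⊔y x<n y<n)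

cellColour-stack-increasing : ∀ {k x y x' y' i i'} (c : CellView k x y) (c' : CellView k x' y') →
                              x < x' → y < y' →
                              cellColour c ≡ inj₁ i → cellColour c' ≡ inj₁ i' → i < i'
cellColour-stack-increasing (core X Y a<k b<k) (core X' Y' a'<k b'<k) x<x' y<y' =
  blockColour-stack-increasing (blockType X Y) (blockType X' Y')
    (block-lex a<k a'<k x<x') (block-lex b<k b'<k y<y')
cellColour-stack-increasing {k} (core X Y a<k b<k) (hook _) _ _ e refl =
  <-≤-trans (All-inj₁ (blockColour-bounded (blockType X Y) a<k b<k ≤-refl) e) (m≤m+n k _)
cellColour-stack-increasing (hook 3k≤x⊔y) (core X' Y' a'<k b'<k) x<x' y<y' _ _ =
  ⊥-elim (<-irrefl refl (<-≤-trans (⊔-pres-<m (blockStart+a<3k X' a'<k) (blockStart+a<3k Y' b'<k))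
                                    (≤-trans 3k≤x⊔y (<⇒≤ (⊔-mono-< x<x' y<y')))))
cellColour-stack-increasing {k} (hook 3k≤x⊔y) (hook _) x<x' y<y' refl refl =
  hookIndex-increasing {k} 3k≤x⊔y x<x' y<y'

cellColour-queue-increasing : ∀ {k x y x' y' i i'} (c : CellView k x y) (c' : CellView k x' y') →
                              x < x' → y' < y →
                              cellColour c ≡ inj₂ i → cellColour c' ≡ inj₂ i' → i < i'
cellColour-queue-increasing (core X Y a<k b<k) (core X' Y' a'<k b'<k) x<x' y'<y =
  blockColour-queue-increasing (blockType X Y) (blockType X' Y') b<k
    (block-lex a<k a'<k x<x') (block-lex b'<k b<k y'<y)

blockColouring : ∀ k r → GridColouring (3 * k + r) (k + r) k
blockColouring k r = record
  { colour     = colour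
  ; bounded    = λ x y → cellColour-bounded (cell x y) (toℕ<n x) (toℕ<n y)
  ; stack-free = λ x<x' y<y' e e' →
      <-irrefl refl (cellColour-stack-increasing (cell _ _) (cell _ _) x<x' y<y' e e')
  ; queue-free = λ x<x' y'<y e e' →
      <-irrefl refl (cellColour-queue-increasing (cell _ _) (cell _ _) x<x' y'<y e e')
  }
  where
  cell : (x y : Fin (3 * k + r)) → CellView k (toℕ x) (toℕ y)
  cell x y = cellView k (toℕ x) (toℕ y)

  colour : Fin (3 * k + r) → Fin (3 * k + r) → ℕ ⊎ ℕ
  colour x y = cellColour (cell x y)

classes≤ceil2n/3 : ∀ k r → r ≤ 2 → (k + r) + k ≤ ceil2n/3 (3 * k + r)
classes≤ceil2n/3 k r r≤2 = begin
  (k + r) + k                   ≡⟨ m*n/n≡m ((k + r) + k) 3 ⟨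
  ((k + r) + k) * 3 / 3         ≡⟨ cong (_/ 3) three-classes ⟩
  (2 * (3 * k + r) + r) / 3     ≤⟨ /-monoˡ-≤ 3 (+-monoʳ-≤ (2 * (3 * k + r)) r≤2) ⟩
  (2 * (3 * k + r) + 2) / 3     ∎
  where
  open ≤-Reasoning
  open +-*-Solver

  three-classes : ((k + r) + k) * 3 ≡ 2 * (3 * k + r) + r
  three-classes = solve 2 (λ k r → ((k :+ r) :+ k) :* con 3 := con 2 :* (con 3 :* k :+ r) :+ r) refl k r

n≡3[n/3]+n%3 : ∀ n → n ≡ 3 * (n / 3) + n % 3
n≡3[n/3]+n%3 n = begin
  n                     ≡⟨ m≡m%n+[m/n]*n n 3 ⟩
  n % 3 + n / 3 * 3     ≡⟨ +-comm (n % 3) _ ⟩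
  n / 3 * 3 + n % 3     ≡⟨ cong (_+ n % 3) (*-comm (n / 3) 3) ⟩
  3 * (n / 3) + n % 3   ∎
  where open ≡-Reasoning

lemma3 : (n : ℕ) → n ≥ 1 → MixedSepNumberAtMost n (ceil2n/3 n)
lemma3 n _ =
  subst (λ m → MixedSepNumberAtMost m (ceil2n/3 m)) (sym (n≡3[n/3]+n%3 n))
    (gridColouring⇒mixedSepNumber (blockColouring k r)
      (classes≤ceil2n/3 k r (s≤s⁻¹ (m%n<n n 3))))
  where
  k r : ℕ
  k = n / 3
  r = n % 3
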